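{- Let $\mathbf{s} = (s_k)_{k \geq 1}$ be a sequence of independent random variables, each uniformly distributed in $\{ -1,+1\}$. Then for all integers $n \geq 4$ and $d \geq 12$, \[ \mathbb{P}\big[d \in \mathcal{L}_\mathbf{s}(n)\big] = 1 - \big(\tfrac12\big)^{P(d,n)}. \]
   Context: For integers $a, h \geq 1$, $\mathcal{D}_a(h) := \{d \in \mathbb{N} : d \mid ah,\ \gcd(ah/d, a) = 1\}$. For a sequence $\mathbf{s}$ in $\{ -1,+1\}$ and $n \geq 4$, \[ \mathcal{L}_\mathbf{s}(n) := \bigcup_{a \in \{1,2,3,6\}} \ \bigcup_{h \in \mathcal{K}_{a,\mathbf{s}}(n)} \mathcal{D}_a(h), \] where, with $h$ ranging over positive integers, $\mathcal{K}_{1,\mathbf{s}}(n) := \{h \leq n/2 : s_{2h-1} = (-1)^h \text{ or } s_{2h+1} = (-1)^{h+1}\}$, $\mathcal{K}_{2,\mathbf{s}}(n) := \{h \leq n/2 : s_{2h-1} = (-1)^{h+1} \text{ or } s_{2h+1} = (-1)^{h}\}$, $\mathcal{K}_{3,\mathbf{s}}(n) := \{h \leq n/2 : s_{2h} = (-1)^h\}$, $\mathcal{K}_{6,\mathbf{s}}(n) := \{h \leq n/2 : s_{2h} = (-1)^{h+1}\}$. For integers $d, n \geq 1$: $P(d,n) := 2\lfloor n/(2d) \rfloor$ if $d \equiv 1, 5 \pmod 6$; $P(d,n) := 2\lfloor n/d \rfloor$ if $d \equiv 2, 4 \pmod 6$; $P(d,n) := \lfloor 3n/(2d) \rfloor +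 \lfloor n/(2d) \rfloor$ if $d \equiv 3 \pmod 6$; $P(d,n) := \lfloor 3n/d \rfloor + \lfloor n/d \rfloor$ if $d \equiv 0 \pmod 6$. -}

module Defs where

open import Data.Nat using (ℕ; zero; suc; _+_; _*_; _∸_; _≤_; _/_; _%_)
open import Data.Nat.Divisibility using (_∣_; quotient)
open import Data.Nat.GCD using (gcd)
open import Data.Vec using (Vec; []; _∷_)
open import Data.Product using (Σ; _×_)
open import Data.Sum using (_⊎_)
open import Relation.Binary.PropositionalEquality using (_≡_)

data PM : Set where
  plus minus : PM

neg : PM → PM
neg plus  = minus
neg minus = plus

negOnePow : ℕ → PM
negOnePow zero    = plus
negOnePow (suc h) = neg (negOnePow h)

-- A sign sequence s = (s_k)_{k ≥ 1}; the value at k = 0 is unused.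
Seq : Set
Seq = ℕ → PM

InD : ℕ → ℕ → ℕ → Set
InD a h d = (1 ≤ d) × Σ (d ∣ a * h) (λ p → gcd (quotient p) a ≡ 1)

InK1 InK2 InK3 InK6 : Seq → ℕ → ℕ → Set
InK1 s n h = (1 ≤ h) × (2 * h ≤ n) ×
  ((s (2 * h ∸ 1) ≡ negOnePow h) ⊎ (s (2 * h + 1) ≡ negOnePow (h + 1)))
InK2 s n h = (1 ≤ h) × (2 * h ≤ n) ×
  ((s (2 * h ∸ 1) ≡ negOnePow (h + 1)) ⊎ (s (2 * h + 1) ≡ negOnePow h))
InK3 s n h = (1 ≤ h) × (2 * h ≤ n) × (s (2 * h) ≡ negOnePow h)
InK6 s n h = (1 ≤ h) × (2 * h ≤ n) × (s (2 * h) ≡ negOnePow (h + 1))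

InL : Seq → ℕ → ℕ → Set
InL s n d = Σ ℕ λ h →
     (InK1 s n h × InD 1 h d)
   ⊎ (InK2 s n h × InD 2 h d)
   ⊎ (InK3 s n h × InD 3 h d)
   ⊎ (InK6 s n h × InD 6 h d)

-- P(d, n) (only meaningful for d ≥ 1; we return 0 for d = 0)
P : ℕ → ℕ → ℕ
P zero n = 0
P d@(suc _) n with d % 6
... | 1 = 2 * (n / (2 * d))
... | 5 = 2 * (n / (2 * d))
... | 2 = 2 * (n / d)
... | 4 = 2 * (n / d)
... | 3 = (3 * n) / (2 * d) + n / (2 * d)
... | _ = (3 * n) / d + n / d

-- Extend a finite vector (s_1, …, s_m) to a sequence (values outside 1..m are plus, irrelevant)
lookupD : {m : ℕ} → Vec PM m → ℕ → PM
lookupD []       k       = plus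
lookupD (x ∷ xs) zero    = x
lookupD (x ∷ xs) (suc k) = lookupD xs k

toSeq : {m : ℕ} → Vec PM m → Seq
toSeq v zero    = plus
toSeq v (suc k) = lookupD v k

{-# OPTIONS --safe #-}

-- Each h ≤ n/2 can put d into L_s(n) only through single coordinates of s: for a ∈ {1, 2} (when
-- d ∣ 2h) through s_{2h−1} or s_{2h+1}, for a ∈ {3, 6} (when d ∣ 6h, d ∤ 2h) through s_{2h}, and
-- in each case d ∈ L_s(n) as soon as one of these coordinates takes one specific value. For d ≥ 3
-- no coordinate is claimed twice (only consecutive h could share s_{2h+1}, which would force d ∣ 2),
-- so d ∉ L_s(n) says that s avoids one forbidden value at each of K coordinates among s_1 … s_{n+1}.
-- Exactly 2^(n+1−K) sign vectors do so, and K = #{h ≤ n/2 : d ∣ 2h} + #{h ≤ n/2 : d ∣ 6h}, which a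
-- case distinction on d mod 6 turns into P(d, n).

module Submission where

open import Defs
open import Algebra.Properties.CommutativeSemigroup as CSemigroup using ()
open import Data.Bool.Base using (Bool; true; false; if_then_else_)
open import Data.Empty using (⊥)
open import Data.List.Base using (List; []; _∷_; [_]; map; _++_; length)
open import Data.List.Membership.Propositional using (_∈_)
open import Data.List.Membership.Propositional.Properties using (∈-map⁺; ∈-map⁻; ∈-++⁺ˡ; ∈-++⁺ʳ; ∈-++⁻)
open import Data.List.Properties using (length-++; length-map)
open import Data.List.Relation.Unary.All using ([])
open import Data.List.Relation.Unary.AllPairs using ([]; _∷_)
open import Data.List.Relation.Unary.Any using (here)
open import Data.List.Relation.Unary.Unique.Propositional using (Unique)
import Data.List.Relation.Unary.Unique.Propositional.Properties as Unique
open import Data.Maybe.Base using (Maybe; just; nothing; is-just)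
open import Data.Maybe.Properties using (≡-dec)
open import Data.Nat.Base using (ℕ; zero; suc; _+_; _*_; _^_; _∸_; _/_; _%_; _≤_; _<_; z≤n; s≤s; NonZero; >-nonZero)
open import Data.Nat.Coprimality using (Coprime; gcd≡1⇒coprime; coprime⇒gcd≡1; coprime-divisor; coprime-+; 1-coprimeTo)
open import Data.Nat.Divisibility
  using (_∣_; _∣?_; divides; quotient; ∣-trans; ∣-refl; ∣-reflexive; ∣⇒≤; _∣0; ∣m+n∣m⇒∣n; ∣m∣n⇒∣m+n; n∣m*n; ∣n⇒∣m*n;
         *-cancelˡ-∣; *-monoʳ-∣)
open import Data.Nat.DivMod
  using (m≡m%n+[m/n]*n; m%n<n; +-distrib-/-∣ʳ; m*n/n≡m; m<n⇒m/n≡0; n/n≡1; 0/n≡0; m/n/o≡m/[n*o]; m*n/m*o≡n/o;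
         /-congˡ; /-congʳ)
open import Data.Nat.GCD using (gcd-zeroʳ)
open import Data.Nat.Properties
  using (_≤?_; +-comm; +-assoc; +-suc; +-identityʳ; +-commutativeSemigroup; *-comm; *-assoc; *-identityˡ;
         *-distribʳ-+; *-distribʳ-∸; *-cancelˡ-≡; *-cancelʳ-≡; *-monoʳ-≤; m*n≢0; m+n∸n≡m; ≤-refl; ≤-reflexive;
         ≤-trans; <⇒≱; n≤1+n; m≤m+n; m≤n⇒m≤1+n; m≤n⇒m<n∨m≡n)
open import Data.Nat.Tactic.RingSolver using (solve-∀)
open import Data.Product.Base using (Σ; ∃; _×_; _,_; proj₂)
open import Data.Sum.Base using (_⊎_; inj₁; inj₂; [_,_]′)
open import Data.Vec.Base using (Vec; []; _∷_)
open import Data.Vec.Properties using (∷-injectiveʳ)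
open import Function.Base using (_∘_)
open import Function.Bundles using (_⇔_; mk⇔; Equivalence)
import Function.Properties.Equivalence as ⇔
open import Relation.Binary.Definitions using (DecidableEquality)
open import Relation.Binary.PropositionalEquality using (_≡_; refl; sym; trans; cong; cong₂; subst; module ≡-Reasoning)
open import Relation.Nullary using (¬_; Dec; yes; no; does; contradiction; _×-dec_; ¬?)
open import Relation.Nullary.Decidable using (dec-true; dec-false; does-⇔; from-no)
open import Relation.Unary using (Decidable)

open CSemigroup +-commutativeSemigroup using () renaming (interchange to +-interchange)
open ≡-Reasoning

_≟±_ : DecidableEquality PM
plus  ≟± plus  = yes refl
minus ≟± minus = yes refl
plus  ≟± minus = no λ ()
minus ≟± plus  = no λ ()

_≟ₘ_ : DecidableEquality (Maybe PM)
_≟ₘ_ = ≡-dec _≟±_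

neg-involutive : ∀ x → neg (neg x) ≡ x
neg-involutive plus  = refl
neg-involutive minus = refl

negOnePow-+1 : ∀ h → negOnePow (h + 1) ≡ neg (negOnePow h)
negOnePow-+1 h = cong negOnePow (+-comm h 1)

negOnePow-+2 : ∀ h → negOnePow (suc h + 1) ≡ negOnePow h
negOnePow-+2 h = trans (cong neg (negOnePow-+1 h)) (neg-involutive (negOnePow h))

2[1+h]≡2+2h : ∀ h → 2 * suc h ≡ suc (suc (2 * h))
2[1+h]≡2+2h h = cong suc (+-suc h (h + 0))

2h+1≡suc2h : ∀ h → 2 * h + 1 ≡ suc (2 * h)
2h+1≡suc2h h = +-comm (2 * h) 1

2[1+h]∸1≡suc2h : ∀ h → 2 * suc h ∸ 1 ≡ suc (2 * h)
2[1+h]∸1≡suc2h h = +-suc h (h + 0)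

half : ℕ → ℕ ⊎ ℕ
half zero    = inj₁ 0
half (suc k) = [ inj₂ , inj₁ ∘ suc ]′ (half k)

half-even : ∀ h → half (2 * h) ≡ inj₁ h
half-odd  : ∀ h → half (suc (2 * h)) ≡ inj₂ h
half-even zero    = refl
half-even (suc h) = cong [ inj₂ , inj₁ ∘ suc ]′ (trans (cong half (+-suc h (h + 0))) (half-odd h))
half-odd h rewrite half-even h = refl

even-or-odd : ∀ k → (∃ λ h → k ≡ 2 * h) ⊎ (∃ λ h → k ≡ suc (2 * h))
even-or-odd zero = inj₁ (0 , refl)
even-or-odd (suc k) with even-or-odd k
... | inj₁ (h , refl) = inj₂ (h , refl)
... | inj₂ (h , refl) = inj₁ (suc h , sym (2[1+h]≡2+2h h))

parity-/2 : ∀ n → n ≡ 2 * (n / 2) ⊎ n ≡ suc (2 * (n / 2))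
parity-/2 n with n % 2 | m≡m%n+[m/n]*n n 2 | m%n<n n 2
... | 0 | n≡ | _ = inj₁ (trans n≡ (*-comm (n / 2) 2))
... | 1 | n≡ | _ = inj₂ (trans n≡ (cong suc (*-comm (n / 2) 2)))
... | suc (suc _) | _ | s≤s (s≤s ())

∣2h⇒∣6h : ∀ {d} h → d ∣ 2 * h → d ∣ 6 * h
∣2h⇒∣6h {d} h d∣2h = subst (d ∣_) (sym (*-assoc 3 2 h)) (∣n⇒∣m*n 3 d∣2h)

∣3h⇒∣6h : ∀ {d} h → d ∣ 3 * h → d ∣ 6 * h
∣3h⇒∣6h {d} h d∣3h = subst (d ∣_) (sym (*-assoc 2 3 h)) (∣n⇒∣m*n 2 d∣3h)

∣2h⇒∣3h⇒∣h : ∀ {d} h → d ∣ 2 * h → d ∣ 3 * h → d ∣ h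
∣2h⇒∣3h⇒∣h {d} h d∣2h d∣3h = ∣m+n∣m⇒∣n (subst (d ∣_) 3h≡2h+h d∣3h) d∣2h
  where
  3h≡2h+h : 3 * h ≡ 2 * h + h
  3h≡2h+h = trans (*-distribʳ-+ h 2 1) (cong (2 * h +_) (*-identityˡ h))

⟦_⟧ : Bool → ℕ
⟦ true  ⟧ = 1
⟦ false ⟧ = 0

⟦yes⟧ : ∀ {P : Set} (p? : Dec P) → P → ⟦ does p? ⟧ ≡ 1
⟦yes⟧ p? p = cong ⟦_⟧ (dec-true p? p)

⟦no⟧ : ∀ {P : Set} (p? : Dec P) → ¬ P → ⟦ does p? ⟧ ≡ 0
⟦no⟧ p? ¬p = cong ⟦_⟧ (dec-false p? ¬p)

∑ : ℕ → (ℕ → ℕ) → ℕ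
∑ zero    f = 0
∑ (suc m) f = ∑ m f + f (suc m)

∑-suc : ∀ m f → ∑ (suc m) f ≡ f 1 + ∑ m (f ∘ suc)
∑-suc zero    f = +-comm 0 (f 1)
∑-suc (suc m) f = trans (cong (_+ f (suc (suc m))) (∑-suc m f)) (+-assoc (f 1) _ _)

∑-cong : ∀ m {f g} → (∀ {k} → 1 ≤ k → k ≤ m → f k ≡ g k) → ∑ m f ≡ ∑ m g
∑-cong zero    _   = refl
∑-cong (suc m) f≗g = cong₂ _+_ (∑-cong m λ 1≤k k≤m → f≗g 1≤k (m≤n⇒m≤1+n k≤m)) (f≗g (s≤s z≤n) ≤-refl)

∑-+ : ∀ m f g → ∑ m (λ k → f k + g k) ≡ ∑ m f + ∑ m g
∑-+ zero    f g = refl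
∑-+ (suc m) f g = trans (cong (_+ (f (suc m) + g (suc m))) (∑-+ m f g)) (+-interchange (∑ m f) (∑ m g) _ _)

∑-shift : ∀ m f → f 1 ≡ 0 → f (suc m) ≡ 0 → ∑ m (f ∘ suc) ≡ ∑ m f
∑-shift m f f₁≡0 fₘ₊₁≡0 = begin
  ∑ m (f ∘ suc)        ≡⟨ cong (_+ ∑ m (f ∘ suc)) (sym f₁≡0) ⟩
  f 1 + ∑ m (f ∘ suc)  ≡⟨ sym (∑-suc m f) ⟩
  ∑ m f + f (suc m)    ≡⟨ cong (∑ m f +_) fₘ₊₁≡0 ⟩
  ∑ m f + 0            ≡⟨ +-identityʳ (∑ m f) ⟩
  ∑ m f                ∎

∑-pairs : ∀ N f → ∑ (suc (2 * N)) f ≡ f 1 + ∑ N (λ h → f (2 * h) + f (suc (2 * h)))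
∑-pairs zero    f = +-comm 0 (f 1)
∑-pairs (suc N) f = begin
  ∑ (suc (2 * suc N)) f                            ≡⟨ cong (λ m → ∑ (suc m) f) (2[1+h]≡2+2h N) ⟩
  ∑ (suc (2 * N)) f + a + b                        ≡⟨ cong (λ x → x + a + b) (∑-pairs N f) ⟩
  f 1 + S + a + b                                  ≡⟨ +-assoc (f 1 + S) a b ⟩
  f 1 + S + (a + b)                                ≡⟨ +-assoc (f 1) S (a + b) ⟩
  f 1 + (S + (a + b))                              ≡⟨ cong (λ m → f 1 + (S + (f m + f (suc m)))) (sym (2[1+h]≡2+2h N)) ⟩
  f 1 + (S + (f (2 * suc N) + f (suc (2 * suc N)))) ∎
  where
  a b S : ℕ
  a = f (suc (suc (2 * N)))
  b = f (suc (suc (suc (2 * N))))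
  S = ∑ N (λ h → f (2 * h) + f (suc (2 * h)))

-- Sign vectors taking a forbidden value

branch : ∀ {m} → (PM → List (Vec PM m)) → List (Vec PM (suc m))
branch f = map (plus ∷_) (f plus) ++ map (minus ∷_) (f minus)

module _ {m} {f : PM → List (Vec PM m)} where

  ∈-branch⁺ : ∀ x {v} → v ∈ f x → x ∷ v ∈ branch f
  ∈-branch⁺ plus  v∈ = ∈-++⁺ˡ (∈-map⁺ (plus ∷_) v∈)
  ∈-branch⁺ minus v∈ = ∈-++⁺ʳ (map (plus ∷_) (f plus)) (∈-map⁺ (minus ∷_) v∈)

  ∈-branch⁻ : ∀ {x v} → x ∷ v ∈ branch f → v ∈ f x
  ∈-branch⁻ x∷v∈ with ∈-++⁻ (map (plus ∷_) (f plus)) x∷v∈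
  ... | inj₁ ∈₊ with ∈-map⁻ (plus ∷_) ∈₊
  ...   | _ , v∈ , refl = v∈
  ∈-branch⁻ x∷v∈ | inj₂ ∈₋ with ∈-map⁻ (minus ∷_) ∈₋
  ...   | _ , v∈ , refl = v∈

  ∈-branch : ∀ {x v} → x ∷ v ∈ branch f ⇔ v ∈ f x
  ∈-branch {x} = mk⇔ ∈-branch⁻ (∈-branch⁺ x)

  branch-unique : (∀ x → Unique (f x)) → Unique (branch f)
  branch-unique u = Unique.++⁺ (Unique.map⁺ ∷-injectiveʳ (u plus)) (Unique.map⁺ ∷-injectiveʳ (u minus)) heads-differ
    where
    heads-differ : ∀ {v} → v ∈ map (plus ∷_) (f plus) × v ∈ map (minus ∷_) (f minus) → ⊥
    heads-differ (∈₊ , ∈₋) with ∈-map⁻ (plus ∷_) ∈₊ | ∈-map⁻ (minus ∷_) ∈₋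
    ... | _ , _ , refl | _ , _ , ()

length-branch : ∀ {m} (f : PM → List (Vec PM m)) → length (branch f) ≡ length (f plus) + length (f minus)
length-branch f = trans (length-++ (map (plus ∷_) (f plus)))
                      (cong₂ _+_ (length-map (plus ∷_) (f plus)) (length-map (minus ∷_) (f minus)))

signVectors : (m : ℕ) → List (Vec PM m)
signVectors zero    = [ [] ]
signVectors (suc m) = branch λ _ → signVectors m

∈-signVectors : ∀ {m} (v : Vec PM m) → v ∈ signVectors m
∈-signVectors []      = here refl
∈-signVectors (x ∷ v) = ∈-branch⁺ x (∈-signVectors v)

signVectors-unique : ∀ m → Unique (signVectors m)
signVectors-unique zero    = [] ∷ []
signVectors-unique (suc m) = branch-unique λ _ → signVectors-unique m

length-signVectors : ∀ m → length (signVectors m) ≡ 2 ^ m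
length-signVectors zero    = refl
length-signVectors (suc m) = begin
  length (signVectors (suc m))                          ≡⟨ length-branch (λ _ → signVectors m) ⟩
  length (signVectors m) + length (signVectors m)       ≡⟨ cong (λ l → l + l) (length-signVectors m) ⟩
  2 ^ m + 2 ^ m                                         ≡⟨ cong (2 ^ m +_) (sym (+-identityʳ (2 ^ m))) ⟩
  2 ^ suc m                                             ∎

-- c k = just b forbids the value b at position k; positions start at 1, as in toSeq.
Forbidden : Set
Forbidden = ℕ → Maybe PM

forbiddenCount : Forbidden → ℕ → ℕ
forbiddenCount c m = ∑ m (λ k → ⟦ is-just (c k) ⟧)

Hits : ∀ {m} → Forbidden → Vec PM m → Set
Hits {m} c v = ∃ λ k → 1 ≤ k × k ≤ m × c k ≡ just (toSeq v k)

Hits-∷ : ∀ {m} {c : Forbidden} {x} {v : Vec PM m} → Hits c (x ∷ v) ⇔ (c 1 ≡ just x ⊎ Hits (c ∘ suc) v)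
Hits-∷ {m} {c} {x} {v} = mk⇔ to from
  where
  to : Hits c (x ∷ v) → c 1 ≡ just x ⊎ Hits (c ∘ suc) v
  to (1 , _ , _ , c₁≡x) = inj₁ c₁≡x
  to (suc (suc k) , _ , s≤s k<m , cₖ≡vₖ) = inj₂ (suc k , s≤s z≤n , k<m , cₖ≡vₖ)
  from : c 1 ≡ just x ⊎ Hits (c ∘ suc) v → Hits c (x ∷ v)
  from (inj₁ c₁≡x) = 1 , s≤s z≤n , s≤s z≤n , c₁≡x
  from (inj₂ (suc k , _ , k≤m , cₖ≡vₖ)) = suc (suc k) , s≤s z≤n , s≤s k≤m , cₖ≡vₖ

hitting : Forbidden → (m : ℕ) → List (Vec PM m)
hittingAfter : Forbidden → (m : ℕ) → PM → List (Vec PM m)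

hitting c zero    = []
hitting c (suc m) = branch (hittingAfter c m)

hittingAfter c m x = if does (c 1 ≟ₘ just x) then signVectors m else hitting (c ∘ suc) m

∈-hitting : ∀ {m} (c : Forbidden) (v : Vec PM m) → v ∈ hitting c m ⇔ Hits c v
∈-hitting c []      = mk⇔ (λ ()) λ { (suc _ , _ , () , _) }
∈-hitting c (x ∷ v) = ⇔.trans (∈-branch {f = hittingAfter c _}) (⇔.trans ∈-hittingAfter (⇔.sym Hits-∷))
  where
  ∈-hittingAfter : v ∈ hittingAfter c _ x ⇔ (c 1 ≡ just x ⊎ Hits (c ∘ suc) v)
  ∈-hittingAfter with c 1 ≟ₘ just x
  ... | yes c₁≡x = mk⇔ (λ _ → inj₁ c₁≡x) (λ _ → ∈-signVectors v)
  ... | no  c₁≢x = mk⇔ (inj₂ ∘ Equivalence.to (∈-hitting (c ∘ suc) v))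
                       [ (λ c₁≡x → contradiction c₁≡x c₁≢x) , Equivalence.from (∈-hitting (c ∘ suc) v) ]′

hitting-unique : ∀ (c : Forbidden) m → Unique (hitting c m)
hitting-unique c zero    = []
hitting-unique c (suc m) = branch-unique hittingAfter-unique
  where
  hittingAfter-unique : ∀ x → Unique (hittingAfter c m x)
  hittingAfter-unique x with c 1 ≟ₘ just x
  ... | yes _ = signVectors-unique m
  ... | no  _ = hitting-unique (c ∘ suc) m

private
  unforced-step : ∀ H X T → H * X + T ≡ X * T → (H + H) * X + 2 * T ≡ X * (2 * T)
  unforced-step H X T ih = begin
    (H + H) * X + 2 * T ≡⟨ regroup H X T ⟩
    2 * (H * X + T)     ≡⟨ cong (2 *_) ih ⟩
    2 * (X * T)         ≡⟨ swap X T ⟩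
    X * (2 * T)         ∎
    where
    regroup : ∀ H X T → (H + H) * X + 2 * T ≡ 2 * (H * X + T)
    regroup = solve-∀
    swap : ∀ X T → 2 * (X * T) ≡ X * (2 * T)
    swap = solve-∀

  forced-step : ∀ H X T → H * X + T ≡ X * T → (T + H) * (2 * X) + 2 * T ≡ (2 * X) * (2 * T)
  forced-step H X T ih = begin
    (T + H) * (2 * X) + 2 * T     ≡⟨ regroup H X T ⟩
    2 * (X * T) + 2 * (H * X + T) ≡⟨ cong (λ y → 2 * (X * T) + 2 * y) ih ⟩
    2 * (X * T) + 2 * (X * T)     ≡⟨ collect X T ⟩
    (2 * X) * (2 * T)             ∎
    where
    regroup : ∀ H X T → (T + H) * (2 * X) + 2 * T ≡ 2 * (X * T) + 2 * (H * X + T)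
    regroup = solve-∀
    collect : ∀ X T → 2 * (X * T) + 2 * (X * T) ≡ (2 * X) * (2 * T)
    collect = solve-∀

length-hittingAfter : ∀ (c : Forbidden) m x →
  length (hittingAfter c m x) ≡ (if does (c 1 ≟ₘ just x) then 2 ^ m else length (hitting (c ∘ suc) m))
length-hittingAfter c m x with c 1 ≟ₘ just x
... | yes _ = length-signVectors m
... | no  _ = refl

-- length-hitting without truncated subtraction, which makes the induction on m go through
length-hitting-+ : ∀ (c : Forbidden) m →
  length (hitting c m) * 2 ^ forbiddenCount c m + 2 ^ m ≡ 2 ^ forbiddenCount c m * 2 ^ m
length-hitting-+ c zero = refl
length-hitting-+ c (suc m)
  rewrite ∑-suc m (λ k → ⟦ is-just (c k) ⟧) | length-branch (hittingAfter c m)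
        | length-hittingAfter c m plus | length-hittingAfter c m minus
  with c 1 | length (hitting (c ∘ suc) m) | forbiddenCount (c ∘ suc) m | length-hitting-+ (c ∘ suc) m
... | nothing    | H | K | ih = unforced-step H (2 ^ K) (2 ^ m) ih
... | just plus  | H | K | ih = forced-step H (2 ^ K) (2 ^ m) ih
... | just minus | H | K | ih = trans (cong (λ l → l * 2 ^ suc K + 2 ^ suc m) (+-comm H (2 ^ m))) (forced-step H (2 ^ K) (2 ^ m) ih)

length-hitting : ∀ (c : Forbidden) m →
  length (hitting c m) * 2 ^ forbiddenCount c m ≡ (2 ^ forbiddenCount c m ∸ 1) * 2 ^ m
length-hitting c m = begin
  L * X          ≡⟨ sym (m+n∸n≡m (L * X) T) ⟩
  L * X + T ∸ T  ≡⟨ cong (_∸ T) (length-hitting-+ c m) ⟩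
  X * T ∸ T      ≡⟨ cong (X * T ∸_) (sym (*-identityˡ T)) ⟩
  X * T ∸ 1 * T  ≡⟨ sym (*-distribʳ-∸ T X 1) ⟩
  (X ∸ 1) * T    ∎
  where
  L X T : ℕ
  L = length (hitting c m)
  X = 2 ^ forbiddenCount c m
  T = 2 ^ m

-- The divisor sets D_a(h)

divisor-of-6 : ∀ {i} → i ∣ 6 → i ≡ 1 ⊎ 2 ∣ i ⊎ 3 ∣ i
divisor-of-6 {0} _   = inj₂ (inj₁ (2 ∣0))
divisor-of-6 {1} _   = inj₁ refl
divisor-of-6 {2} _   = inj₂ (inj₁ ∣-refl)
divisor-of-6 {3} _   = inj₂ (inj₂ ∣-refl)
divisor-of-6 {4} _   = inj₂ (inj₁ (divides 2 refl))
divisor-of-6 {5} 5∣6 = contradiction 5∣6 (from-no (5 ∣? 6))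
divisor-of-6 {6} _   = inj₂ (inj₁ (divides 3 refl))
divisor-of-6 {suc (suc (suc (suc (suc (suc (suc _))))))} i∣6 with ∣⇒≤ i∣6
... | s≤s (s≤s (s≤s (s≤s (s≤s (s≤s ())))))

coprime-to-divisor-of-6 : ∀ {a q} → a ∣ 6 → (2 ∣ a → ¬ 2 ∣ q) → (3 ∣ a → ¬ 3 ∣ q) → Coprime q a
coprime-to-divisor-of-6 a∣6 2∤q 3∤q (i∣q , i∣a) with divisor-of-6 (∣-trans i∣a a∣6)
... | inj₁ i≡1        = i≡1
... | inj₂ (inj₁ 2∣i) = contradiction (∣-trans 2∣i i∣q) (2∤q (∣-trans 2∣i i∣a))
... | inj₂ (inj₂ 3∣i) = contradiction (∣-trans 3∣i i∣q) (3∤q (∣-trans 3∣i i∣a))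

-- Read with a = c b, this checks the condition gcd (a h / d) a ≡ 1 of D_a(h) one prime c ∈ {2, 3} at a time.
∣-quotient⇔ : ∀ c b {d h} .{{_ : NonZero c}} .{{_ : NonZero d}} (d∣cbh : d ∣ c * b * h) →
              c ∣ quotient d∣cbh ⇔ d ∣ b * h
∣-quotient⇔ c b {d} {h} (divides q cbh≡qd) = mk⇔ to from
  where
  to : c ∣ q → d ∣ b * h
  to (divides r q≡rc) = divides r (*-cancelˡ-≡ (b * h) (r * d) c (begin
    c * (b * h) ≡⟨ sym (*-assoc c b h) ⟩
    c * b * h   ≡⟨ cbh≡qd ⟩
    q * d       ≡⟨ cong (_* d) (trans q≡rc (*-comm r c)) ⟩
    c * r * d   ≡⟨ *-assoc c r d ⟩
    c * (r * d) ∎))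
  from : d ∣ b * h → c ∣ q
  from (divides r bh≡rd) = divides r (*-cancelʳ-≡ q (r * c) d (begin
    q * d       ≡⟨ sym cbh≡qd ⟩
    c * b * h   ≡⟨ *-assoc c b h ⟩
    c * (b * h) ≡⟨ cong (c *_) bh≡rd ⟩
    c * (r * d) ≡⟨ sym (*-assoc c r d) ⟩
    c * r * d   ≡⟨ cong (_* d) (*-comm c r) ⟩
    r * c * d   ∎))

module _ {d : ℕ} (1≤d : 1 ≤ d) (h : ℕ) where

  private instance
    d≢0 : NonZero d
    d≢0 = >-nonZero 1≤d

  private
    open Equivalence using () renaming (to to forth; from to back)

    1*h : d ∣ 1 * h ⇔ d ∣ h
    1*h = mk⇔ (subst (d ∣_) (*-identityˡ h)) (subst (d ∣_) (sym (*-identityˡ h)))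

  InD₁⇔ : InD 1 h d ⇔ d ∣ h
  InD₁⇔ = mk⇔ (λ (_ , d∣h , _) → forth 1*h d∣h)
              (λ d∣h → 1≤d , back 1*h d∣h , gcd-zeroʳ (quotient (back 1*h d∣h)))

  InD₂⇔ : InD 2 h d ⇔ (d ∣ 2 * h × ¬ d ∣ h)
  InD₂⇔ = mk⇔ to from
    where
    2∣q⇔ : (d∣2h : d ∣ 2 * h) → 2 ∣ quotient d∣2h ⇔ d ∣ h
    2∣q⇔ d∣2h = ⇔.trans (∣-quotient⇔ 2 1 {h = h} d∣2h) 1*h
    to : InD 2 h d → d ∣ 2 * h × ¬ d ∣ h
    to (_ , d∣2h , g) = d∣2h , λ d∣h → contradiction (gcd≡1⇒coprime g (back (2∣q⇔ d∣2h) d∣h , ∣-refl)) λ ()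
    from : d ∣ 2 * h × ¬ d ∣ h → InD 2 h d
    from (d∣2h , d∤h) = 1≤d , d∣2h , coprime⇒gcd≡1 (coprime-to-divisor-of-6 {q = quotient d∣2h} (divides 3 refl)
      (λ _ → d∤h ∘ forth (2∣q⇔ d∣2h)) (λ 3∣2 → contradiction 3∣2 (from-no (3 ∣? 2))))

  InD₃⇔ : InD 3 h d ⇔ (d ∣ 3 * h × ¬ d ∣ h)
  InD₃⇔ = mk⇔ to from
    where
    3∣q⇔ : (d∣3h : d ∣ 3 * h) → 3 ∣ quotient d∣3h ⇔ d ∣ h
    3∣q⇔ d∣3h = ⇔.trans (∣-quotient⇔ 3 1 {h = h} d∣3h) 1*h
    to : InD 3 h d → d ∣ 3 * h × ¬ d ∣ h
    to (_ , d∣3h , g) = d∣3h , λ d∣h → contradiction (gcd≡1⇒coprime g (back (3∣q⇔ d∣3h) d∣h , ∣-refl)) λ ()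
    from : d ∣ 3 * h × ¬ d ∣ h → InD 3 h d
    from (d∣3h , d∤h) = 1≤d , d∣3h , coprime⇒gcd≡1 (coprime-to-divisor-of-6 {q = quotient d∣3h} (divides 2 refl)
      (λ 2∣3 → contradiction 2∣3 (from-no (2 ∣? 3))) (λ _ → d∤h ∘ forth (3∣q⇔ d∣3h)))

  InD₆⇔ : InD 6 h d ⇔ (d ∣ 6 * h × ¬ d ∣ 2 * h × ¬ d ∣ 3 * h)
  InD₆⇔ = mk⇔ to from
    where
    to : InD 6 h d → d ∣ 6 * h × ¬ d ∣ 2 * h × ¬ d ∣ 3 * h
    to (_ , d∣6h , g) = d∣6h
      , (λ d∣2h → contradiction (gcd≡1⇒coprime g (back (∣-quotient⇔ 3 2 {h = h} d∣6h) d∣2h , divides 2 refl)) λ ())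
      , (λ d∣3h → contradiction (gcd≡1⇒coprime g (back (∣-quotient⇔ 2 3 {h = h} d∣6h) d∣3h , divides 3 refl)) λ ())
    from : d ∣ 6 * h × ¬ d ∣ 2 * h × ¬ d ∣ 3 * h → InD 6 h d
    from (d∣6h , d∤2h , d∤3h) = 1≤d , d∣6h , coprime⇒gcd≡1 (coprime-to-divisor-of-6 {q = quotient d∣6h} ∣-refl
      (λ _ → d∤3h ∘ forth (∣-quotient⇔ 2 3 {h = h} d∣6h)) (λ _ → d∤2h ∘ forth (∣-quotient⇔ 3 2 {h = h} d∣6h)))

-- Trigger n d k b: the single value s_k = b already puts d into L_s(n). The subscript is a; right
-- constructors are indexed by the h of the paper (k = 2h + 1), left ones by h − 1 (k = 2h − 1).
data Trigger (n d : ℕ) : ℕ → PM → Set where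
  right₁  : ∀ {h} → 1 ≤ h → 2 * h ≤ n → d ∣ h → Trigger n d (suc (2 * h)) (neg (negOnePow h))
  right₂  : ∀ {h} → 1 ≤ h → 2 * h ≤ n → d ∣ 2 * h → ¬ d ∣ h → Trigger n d (suc (2 * h)) (negOnePow h)
  left₁   : ∀ {h} → 2 * suc h ≤ n → d ∣ suc h → Trigger n d (suc (2 * h)) (negOnePow (suc h))
  left₂   : ∀ {h} → 2 * suc h ≤ n → d ∣ 2 * suc h → ¬ d ∣ suc h → Trigger n d (suc (2 * h)) (negOnePow h)
  middle₃ : ∀ {h} → 1 ≤ h → 2 * h ≤ n → d ∣ 3 * h → ¬ d ∣ h → Trigger n d (2 * h) (negOnePow h)
  middle₆ : ∀ {h} → 1 ≤ h → 2 * h ≤ n → d ∣ 6 * h → ¬ d ∣ 2 * h → ¬ d ∣ 3 * h →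
            Trigger n d (2 * h) (neg (negOnePow h))

Triggered : ℕ → ℕ → Seq → Set
Triggered n d s = Σ ℕ λ k → Σ PM λ b → Trigger n d k b × s k ≡ b

module _ {n d : ℕ} (s : Seq) (1≤d : 1 ≤ d) where
  open Equivalence

  InL⇒Triggered : InL s n d → Triggered n d s
  InL⇒Triggered (zero , inj₁ ((() , _) , _))
  InL⇒Triggered (zero , inj₂ (inj₁ ((() , _) , _)))
  InL⇒Triggered (suc h , inj₁ ((_ , 2h≤n , inj₁ sₖ≡b) , D)) =
    _ , _ , left₁ 2h≤n (to (InD₁⇔ 1≤d (suc h)) D) , trans (cong s (sym (2[1+h]∸1≡suc2h h))) sₖ≡b
  InL⇒Triggered (h , inj₁ ((1≤h , 2h≤n , inj₂ sₖ≡b) , D)) =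
    _ , _ , right₁ 1≤h 2h≤n (to (InD₁⇔ 1≤d h) D) , trans (cong s (sym (2h+1≡suc2h h))) (trans sₖ≡b (negOnePow-+1 h))
  InL⇒Triggered (suc h , inj₂ (inj₁ ((_ , 2h≤n , inj₁ sₖ≡b) , D))) =
    let d∣2h , d∤h = to (InD₂⇔ 1≤d (suc h)) D in
    _ , _ , left₂ 2h≤n d∣2h d∤h , trans (cong s (sym (2[1+h]∸1≡suc2h h))) (trans sₖ≡b (negOnePow-+2 h))
  InL⇒Triggered (h , inj₂ (inj₁ ((1≤h , 2h≤n , inj₂ sₖ≡b) , D))) =
    let d∣2h , d∤h = to (InD₂⇔ 1≤d h) D in
    _ , _ , right₂ 1≤h 2h≤n d∣2h d∤h , trans (cong s (sym (2h+1≡suc2h h))) sₖ≡b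
  InL⇒Triggered (h , inj₂ (inj₂ (inj₁ ((1≤h , 2h≤n , sₖ≡b) , D)))) =
    let d∣3h , d∤h = to (InD₃⇔ 1≤d h) D in
    _ , _ , middle₃ 1≤h 2h≤n d∣3h d∤h , sₖ≡b
  InL⇒Triggered (h , inj₂ (inj₂ (inj₂ ((1≤h , 2h≤n , sₖ≡b) , D)))) =
    let d∣6h , d∤2h , d∤3h = to (InD₆⇔ 1≤d h) D in
    _ , _ , middle₆ 1≤h 2h≤n d∣6h d∤2h d∤3h , trans sₖ≡b (negOnePow-+1 h)

  Triggered⇒InL : Triggered n d s → InL s n d
  Triggered⇒InL (_ , _ , right₁ {h} 1≤h 2h≤n d∣h , sₖ≡b) =
    h , inj₁ ((1≤h , 2h≤n , inj₂ (trans (cong s (2h+1≡suc2h h)) (trans sₖ≡b (sym (negOnePow-+1 h)))))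
             , from (InD₁⇔ 1≤d h) d∣h)
  Triggered⇒InL (_ , _ , right₂ {h} 1≤h 2h≤n d∣2h d∤h , sₖ≡b) =
    h , inj₂ (inj₁ ((1≤h , 2h≤n , inj₂ (trans (cong s (2h+1≡suc2h h)) sₖ≡b)) , from (InD₂⇔ 1≤d h) (d∣2h , d∤h)))
  Triggered⇒InL (_ , _ , left₁ {h} 2h≤n d∣h , sₖ≡b) =
    suc h , inj₁ ((s≤s z≤n , 2h≤n , inj₁ (trans (cong s (2[1+h]∸1≡suc2h h)) sₖ≡b))
                 , from (InD₁⇔ 1≤d (suc h)) d∣h)
  Triggered⇒InL (_ , _ , left₂ {h} 2h≤n d∣2h d∤h , sₖ≡b) =
    suc h , inj₂ (inj₁ ((s≤s z≤n , 2h≤n , inj₁ (trans (cong s (2[1+h]∸1≡suc2h h))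
                                                       (trans sₖ≡b (sym (negOnePow-+2 h)))))
                       , from (InD₂⇔ 1≤d (suc h)) (d∣2h , d∤h)))
  Triggered⇒InL (_ , _ , middle₃ {h} 1≤h 2h≤n d∣3h d∤h , sₖ≡b) =
    h , inj₂ (inj₂ (inj₁ ((1≤h , 2h≤n , sₖ≡b) , from (InD₃⇔ 1≤d h) (d∣3h , d∤h))))
  Triggered⇒InL (_ , _ , middle₆ {h} 1≤h 2h≤n d∣6h d∤2h d∤3h , sₖ≡b) =
    h , inj₂ (inj₂ (inj₂ ((1≤h , 2h≤n , trans sₖ≡b (sym (negOnePow-+1 h)))
                         , from (InD₆⇔ 1≤d h) (d∣6h , d∤2h , d∤3h))))

  InL⇔Triggered : InL s n d ⇔ Triggered n d s
  InL⇔Triggered = mk⇔ InL⇒Triggered Triggered⇒InL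

module _ (n d : ℕ) where

  -- h owns the positions 2h ± 1 (the cases a = 1, 2) resp. the position 2h (a = 3, 6)
  OddOwner EvenOwner : ℕ → Set
  OddOwner h  = 1 ≤ h × 2 * h ≤ n × d ∣ 2 * h
  EvenOwner h = 1 ≤ h × 2 * h ≤ n × d ∣ 6 * h × ¬ d ∣ 2 * h

  oddOwner? : Decidable OddOwner
  oddOwner? h = 1 ≤? h ×-dec 2 * h ≤? n ×-dec d ∣? 2 * h

  evenOwner? : Decidable EvenOwner
  evenOwner? h = 1 ≤? h ×-dec 2 * h ≤? n ×-dec d ∣? 6 * h ×-dec ¬? (d ∣? 2 * h)

  -- the triggering value at position 2h + 1 when it is owned by g ∈ {h, h + 1}
  oddValue : ℕ → ℕ → PM
  oddValue h g = if does (d ∣? g) then neg (negOnePow h) else negOnePow h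

  evenValue : ℕ → PM
  evenValue h = if does (d ∣? 3 * h) then negOnePow h else neg (negOnePow h)

  oddTrigger : ℕ → Maybe PM
  oddTrigger h with oddOwner? h | oddOwner? (suc h)
  ... | yes _ | _     = just (oddValue h h)
  ... | no _  | yes _ = just (oddValue h (suc h))
  ... | no _  | no _  = nothing

  evenTrigger : ℕ → Maybe PM
  evenTrigger h with evenOwner? h
  ... | yes _ = just (evenValue h)
  ... | no _  = nothing

  trigger : ℕ → Maybe PM
  trigger k = [ evenTrigger , oddTrigger ]′ (half k)

  trigger-even : ∀ h → trigger (2 * h) ≡ evenTrigger h
  trigger-even h rewrite half-even h = refl

  trigger-odd : ∀ h → trigger (suc (2 * h)) ≡ oddTrigger h
  trigger-odd h rewrite half-odd h = refl

  right-trigger : ∀ {h} → OddOwner h → Trigger n d (suc (2 * h)) (oddValue h h)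
  right-trigger {h} (1≤h , 2h≤n , d∣2h) with d ∣? h
  ... | yes d∣h = right₁ 1≤h 2h≤n d∣h
  ... | no  d∤h = right₂ 1≤h 2h≤n d∣2h d∤h

  left-trigger : ∀ {h} → OddOwner (suc h) → Trigger n d (suc (2 * h)) (oddValue h (suc h))
  left-trigger {h} (_ , 2h≤n , d∣2h) with d ∣? suc h
  ... | yes d∣h = left₁ 2h≤n d∣h
  ... | no  d∤h = left₂ 2h≤n d∣2h d∤h

  middle-trigger : ∀ {h} → EvenOwner h → Trigger n d (2 * h) (evenValue h)
  middle-trigger {h} (1≤h , 2h≤n , d∣6h , d∤2h) with d ∣? 3 * h
  ... | yes d∣3h = middle₃ 1≤h 2h≤n d∣3h (d∤2h ∘ ∣n⇒∣m*n 2)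
  ... | no  d∤3h = middle₆ 1≤h 2h≤n d∣6h d∤2h d∤3h

  trigger-sound : ∀ k {b} → trigger k ≡ just b → Trigger n d k b
  trigger-sound k eq with even-or-odd k
  ... | inj₁ (h , refl) = even-sound h (trans (sym (trigger-even h)) eq)
    where
    even-sound : ∀ h {b} → evenTrigger h ≡ just b → Trigger n d (2 * h) b
    even-sound h eq with evenOwner? h
    even-sound h refl | yes o = middle-trigger o
  ... | inj₂ (h , refl) = odd-sound h (trans (sym (trigger-odd h)) eq)
    where
    odd-sound : ∀ h {b} → oddTrigger h ≡ just b → Trigger n d (suc (2 * h)) b
    odd-sound h eq with oddOwner? h | oddOwner? (suc h)
    odd-sound h refl | yes o | _     = right-trigger o
    odd-sound h refl | no _  | yes o = left-trigger o

  private
    odd-left-bound : ∀ h → 2 * suc h ≤ n → suc (2 * h) ≤ suc n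
    odd-left-bound h 2h≤n = ≤-trans (n≤1+n (suc (2 * h))) (≤-trans (subst (_≤ n) (2[1+h]≡2+2h h) 2h≤n) (n≤1+n n))

  Trigger-range : ∀ {k b} → Trigger n d k b → 1 ≤ k × k ≤ suc n
  Trigger-range (right₁ _ 2h≤n _)   = s≤s z≤n , s≤s 2h≤n
  Trigger-range (right₂ _ 2h≤n _ _) = s≤s z≤n , s≤s 2h≤n
  Trigger-range (left₁ {h} 2h≤n _)   = s≤s z≤n , odd-left-bound h 2h≤n
  Trigger-range (left₂ {h} 2h≤n _ _) = s≤s z≤n , odd-left-bound h 2h≤n
  Trigger-range (middle₃ {h} 1≤h 2h≤n _ _)   = ≤-trans 1≤h (m≤m+n h _) , ≤-trans 2h≤n (n≤1+n n)
  Trigger-range (middle₆ {h} 1≤h 2h≤n _ _ _) = ≤-trans 1≤h (m≤m+n h _) , ≤-trans 2h≤n (n≤1+n n)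

  oddTrigger-right : ∀ {h} → OddOwner h → oddTrigger h ≡ just (oddValue h h)
  oddTrigger-right {h} o with oddOwner? h
  ... | yes _  = refl
  ... | no  ¬o = contradiction o ¬o

  evenTrigger-owner : ∀ {h} → EvenOwner h → evenTrigger h ≡ just (evenValue h)
  evenTrigger-owner {h} o with evenOwner? h
  ... | yes _  = refl
  ... | no  ¬o = contradiction o ¬o

  module _ (d∤2 : ¬ d ∣ 2) where

    owners-apart : ∀ {h} → OddOwner h → ¬ OddOwner (suc h)
    owners-apart {h} (_ , _ , d∣2h) (_ , _ , d∣2[1+h]) =
      d∤2 (∣m+n∣m⇒∣n (subst (d ∣_) (trans (2[1+h]≡2+2h h) (+-comm 2 (2 * h))) d∣2[1+h]) d∣2h)

    oddTrigger-left : ∀ {h} → OddOwner (suc h) → oddTrigger h ≡ just (oddValue h (suc h))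
    oddTrigger-left {h} o with oddOwner? h | oddOwner? (suc h)
    ... | yes o′ | _     = contradiction o (owners-apart o′)
    ... | no _   | yes _ = refl
    ... | no _   | no ¬o = contradiction o ¬o

    trigger-complete : ∀ {k b} → Trigger n d k b → trigger k ≡ just b
    trigger-complete (right₁ {h} 1≤h 2h≤n d∣h)
      rewrite trigger-odd h | oddTrigger-right (1≤h , 2h≤n , ∣n⇒∣m*n 2 d∣h) | dec-true (d ∣? h) d∣h = refl
    trigger-complete (right₂ {h} 1≤h 2h≤n d∣2h d∤h)
      rewrite trigger-odd h | oddTrigger-right (1≤h , 2h≤n , d∣2h) | dec-false (d ∣? h) d∤h = refl
    trigger-complete (left₁ {h} 2h≤n d∣h)
      rewrite trigger-odd h | oddTrigger-left (s≤s z≤n , 2h≤n , ∣n⇒∣m*n 2 d∣h) | dec-true (d ∣? suc h) d∣h = refl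
    trigger-complete (left₂ {h} 2h≤n d∣2h d∤h)
      rewrite trigger-odd h | oddTrigger-left (s≤s z≤n , 2h≤n , d∣2h) | dec-false (d ∣? suc h) d∤h = refl
    trigger-complete (middle₃ {h} 1≤h 2h≤n d∣3h d∤h)
      rewrite trigger-even h
            | evenTrigger-owner (1≤h , 2h≤n , ∣3h⇒∣6h h d∣3h , λ d∣2h → d∤h (∣2h⇒∣3h⇒∣h h d∣2h d∣3h))
            | dec-true (d ∣? 3 * h) d∣3h = refl
    trigger-complete (middle₆ {h} 1≤h 2h≤n d∣6h d∤2h d∤3h)
      rewrite trigger-even h | evenTrigger-owner (1≤h , 2h≤n , d∣6h , d∤2h) | dec-false (d ∣? 3 * h) d∤3h = refl

    Hits⇔Triggered : (v : Vec PM (n + 1)) → Hits trigger v ⇔ Triggered n d (toSeq v)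
    Hits⇔Triggered v = mk⇔ to from
      where
      to : Hits trigger v → Triggered n d (toSeq v)
      to (k , _ , _ , trigger≡vₖ) = k , toSeq v k , trigger-sound k trigger≡vₖ , refl
      from : Triggered n d (toSeq v) → Hits trigger v
      from (k , b , t , vₖ≡b) =
        let 1≤k , k≤1+n = Trigger-range t in
        k , 1≤k , subst (k ≤_) (+-comm 1 n) k≤1+n , trans (trigger-complete t) (cong just (sym vₖ≡b))

-- Counting the forbidden positions

countDivisible : ℕ → ℕ → ℕ → ℕ
countDivisible a d N = ∑ N λ h → ⟦ does (d ∣? a * h) ⟧

module _ (n d : ℕ) (d∤2 : ¬ d ∣ 2) where

  private
    O E F : ℕ → ℕ
    O h = ⟦ does (oddOwner? n d h) ⟧
    E h = ⟦ does (evenOwner? n d h) ⟧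
    F k = ⟦ is-just (trigger n d k) ⟧

    F-even : ∀ h → F (2 * h) ≡ E h
    F-even h = trans (cong (⟦_⟧ ∘ is-just) (trigger-even n d h)) (evenTrigger-defined h)
      where
      evenTrigger-defined : ∀ h → ⟦ is-just (evenTrigger n d h) ⟧ ≡ E h
      evenTrigger-defined h with evenOwner? n d h
      ... | yes o  = sym (⟦yes⟧ (evenOwner? n d h) o)
      ... | no  ¬o = sym (⟦no⟧ (evenOwner? n d h) ¬o)

    F-odd : ∀ h → F (suc (2 * h)) ≡ O h + O (suc h)
    F-odd h = trans (cong (⟦_⟧ ∘ is-just) (trigger-odd n d h)) (oddTrigger-defined h)
      where
      oddTrigger-defined : ∀ h → ⟦ is-just (oddTrigger n d h) ⟧ ≡ O h + O (suc h)
      oddTrigger-defined h with oddOwner? n d h | oddOwner? n d (suc h)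
      ... | yes o  | yes o′  = contradiction o′ (owners-apart n d d∤2 o)
      ... | yes o  | no  ¬o′ = sym (cong₂ _+_ (⟦yes⟧ (oddOwner? n d h) o) (⟦no⟧ (oddOwner? n d (suc h)) ¬o′))
      ... | no  ¬o | yes o′  = sym (cong₂ _+_ (⟦no⟧ (oddOwner? n d h) ¬o) (⟦yes⟧ (oddOwner? n d (suc h)) o′))
      ... | no  ¬o | no  ¬o′ = sym (cong₂ _+_ (⟦no⟧ (oddOwner? n d h) ¬o) (⟦no⟧ (oddOwner? n d (suc h)) ¬o′))

    odd-owned : ∀ {h} → 1 ≤ h → 2 * h ≤ n → O h ≡ ⟦ does (d ∣? 2 * h) ⟧
    odd-owned {h} 1≤h 2h≤n = by-cases (d ∣? 2 * h)
      where
      by-cases : Dec (d ∣ 2 * h) → O h ≡ ⟦ does (d ∣? 2 * h) ⟧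
      by-cases (yes d∣2h) = trans (⟦yes⟧ (oddOwner? n d h) (1≤h , 2h≤n , d∣2h)) (sym (⟦yes⟧ (d ∣? 2 * h) d∣2h))
      by-cases (no  d∤2h) = trans (⟦no⟧ (oddOwner? n d h) (d∤2h ∘ proj₂ ∘ proj₂)) (sym (⟦no⟧ (d ∣? 2 * h) d∤2h))

    owned-6h : ∀ {h} → 1 ≤ h → 2 * h ≤ n → E h + O h ≡ ⟦ does (d ∣? 6 * h) ⟧
    owned-6h {h} 1≤h 2h≤n = by-cases (d ∣? 2 * h) (d ∣? 6 * h)
      where
      not-even : ¬ d ∣ 6 * h ⊎ d ∣ 2 * h → ¬ EvenOwner n d h
      not-even (inj₁ d∤6h) (_ , _ , d∣6h , _)  = d∤6h d∣6h
      not-even (inj₂ d∣2h) (_ , _ , _ , d∤2h)  = d∤2h d∣2h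
      by-cases : Dec (d ∣ 2 * h) → Dec (d ∣ 6 * h) → E h + O h ≡ ⟦ does (d ∣? 6 * h) ⟧
      by-cases (yes d∣2h) _ = begin
        E h + O h             ≡⟨ cong₂ _+_ (⟦no⟧ (evenOwner? n d h) (not-even (inj₂ d∣2h)))
                                           (⟦yes⟧ (oddOwner? n d h) (1≤h , 2h≤n , d∣2h)) ⟩
        1                     ≡⟨ sym (⟦yes⟧ (d ∣? 6 * h) (∣2h⇒∣6h h d∣2h)) ⟩
        ⟦ does (d ∣? 6 * h) ⟧ ∎
      by-cases (no d∤2h) (yes d∣6h) = begin
        E h + O h             ≡⟨ cong₂ _+_ (⟦yes⟧ (evenOwner? n d h) (1≤h , 2h≤n , d∣6h , d∤2h))
                                           (⟦no⟧ (oddOwner? n d h) (d∤2h ∘ proj₂ ∘ proj₂)) ⟩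
        1                     ≡⟨ sym (⟦yes⟧ (d ∣? 6 * h) d∣6h) ⟩
        ⟦ does (d ∣? 6 * h) ⟧ ∎
      by-cases (no d∤2h) (no d∤6h) = begin
        E h + O h             ≡⟨ cong₂ _+_ (⟦no⟧ (evenOwner? n d h) (not-even (inj₁ d∤6h)))
                                           (⟦no⟧ (oddOwner? n d h) (d∤2h ∘ proj₂ ∘ proj₂)) ⟩
        0                     ≡⟨ sym (⟦no⟧ (d ∣? 6 * h) d∤6h) ⟩
        ⟦ does (d ∣? 6 * h) ⟧ ∎

  module _ (N : ℕ) (n≡ : n ≡ 2 * N ⊎ n ≡ suc (2 * N)) where

    private
      2N≤n : 2 * N ≤ n
      2N≤n = [ (λ n≡2N → ≤-reflexive (sym n≡2N))
             , (λ n≡1+2N → subst (2 * N ≤_) (sym n≡1+2N) (n≤1+n (2 * N))) ]′ n≡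

      n<2[1+N] : n < 2 * suc N
      n<2[1+N] = subst (n <_) (sym (2[1+h]≡2+2h N)) n<2+2N
        where
        n<2+2N : n < suc (suc (2 * N))
        n<2+2N = [ (λ n≡2N → subst (_< suc (suc (2 * N))) (sym n≡2N) (n≤1+n (suc (2 * N))))
                 , (λ n≡1+2N → subst (_< suc (suc (2 * N))) (sym n≡1+2N) ≤-refl) ]′ n≡

      beyond : ∀ {A : Set} → 2 * suc N ≤ n → A
      beyond 2[1+N]≤n = contradiction 2[1+N]≤n (<⇒≱ n<2[1+N])

      F₁≡0 : F 1 ≡ 0
      F₁≡0 = trans (F-odd 0) (cong₂ _+_ (⟦no⟧ (oddOwner? n d 0) λ ())
                                        (⟦no⟧ (oddOwner? n d 1) (d∤2 ∘ proj₂ ∘ proj₂)))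

      up-to-odd : ∑ (n + 1) F ≡ ∑ (suc (2 * N)) F
      up-to-odd = [ even-n , odd-n ]′ n≡
        where
        even-n : n ≡ 2 * N → ∑ (n + 1) F ≡ ∑ (suc (2 * N)) F
        even-n n≡2N = cong (λ m → ∑ m F) (trans (cong (_+ 1) n≡2N) (+-comm (2 * N) 1))
        F-beyond : F (suc (suc (2 * N))) ≡ 0
        F-beyond = trans (cong F (sym (2[1+h]≡2+2h N)))
                         (trans (F-even (suc N)) (⟦no⟧ (evenOwner? n d (suc N)) λ (_ , le , _) → beyond le))
        odd-n : n ≡ suc (2 * N) → ∑ (n + 1) F ≡ ∑ (suc (2 * N)) F
        odd-n n≡1+2N = begin
          ∑ (n + 1) F                                ≡⟨ cong (λ m → ∑ m F) (trans (cong (_+ 1) n≡1+2N)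
                                                                                 (+-comm (suc (2 * N)) 1)) ⟩
          ∑ (suc (2 * N)) F + F (suc (suc (2 * N)))  ≡⟨ cong (∑ (suc (2 * N)) F +_) F-beyond ⟩
          ∑ (suc (2 * N)) F + 0                      ≡⟨ +-identityʳ _ ⟩
          ∑ (suc (2 * N)) F                          ∎

      pair : ∀ h → F (2 * h) + F (suc (2 * h)) ≡ E h + O h + O (suc h)
      pair h = trans (cong₂ _+_ (F-even h) (F-odd h)) (sym (+-assoc (E h) (O h) (O (suc h))))

      2h≤n : ∀ {h} → h ≤ N → 2 * h ≤ n
      2h≤n h≤N = ≤-trans (*-monoʳ-≤ 2 h≤N) 2N≤n

    forbiddenCount-trigger : forbiddenCount (trigger n d) (n + 1) ≡ countDivisible 6 d N + countDivisible 2 d N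
    forbiddenCount-trigger = begin
      ∑ (n + 1) F                                      ≡⟨ up-to-odd ⟩
      ∑ (suc (2 * N)) F                                ≡⟨ ∑-pairs N F ⟩
      F 1 + ∑ N (λ h → F (2 * h) + F (suc (2 * h)))    ≡⟨ cong₂ _+_ F₁≡0 (∑-cong N λ {h} _ _ → pair h) ⟩
      ∑ N (λ h → E h + O h + O (suc h))                ≡⟨ ∑-+ N (λ h → E h + O h) (O ∘ suc) ⟩
      ∑ N (λ h → E h + O h) + ∑ N (O ∘ suc)            ≡⟨ cong (∑ N (λ h → E h + O h) +_)
                                                                    (∑-shift N O O₁≡0 Oₙ₊₁≡0) ⟩
      ∑ N (λ h → E h + O h) + ∑ N O                    ≡⟨ cong₂ _+_ (∑-cong N λ 1≤h h≤N → owned-6h 1≤h (2h≤n h≤N))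
                                                                    (∑-cong N λ 1≤h h≤N → odd-owned 1≤h (2h≤n h≤N)) ⟩
      countDivisible 6 d N + countDivisible 2 d N      ∎
      where
      O₁≡0 : O 1 ≡ 0
      O₁≡0 = ⟦no⟧ (oddOwner? n d 1) (d∤2 ∘ proj₂ ∘ proj₂)
      Oₙ₊₁≡0 : O (suc N) ≡ 0
      Oₙ₊₁≡0 = ⟦no⟧ (oddOwner? n d (suc N)) λ (_ , le , _) → beyond le

-- Counting multiples, and P(d, n) by the residue of d mod 6

/-suc : ∀ m n .{{_ : NonZero n}} → suc m / n ≡ m / n + ⟦ does (n ∣? suc m) ⟧
/-suc m n = begin
  suc m / n                   ≡⟨ /-congˡ (1+m≡) ⟩
  (suc r + q * n) / n         ≡⟨ +-distrib-/-∣ʳ (suc r) (n∣m*n q) ⟩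
  suc r / n + q * n / n       ≡⟨ cong₂ _+_ (carry (m≤n⇒m<n∨m≡n (m%n<n m n))) (m*n/n≡m q n) ⟩
  ⟦ does (n ∣? suc m) ⟧ + q   ≡⟨ +-comm _ q ⟩
  q + ⟦ does (n ∣? suc m) ⟧   ∎
  where
  r q : ℕ
  r = m % n
  q = m / n
  1+m≡ : suc m ≡ suc r + q * n
  1+m≡ = cong suc (m≡m%n+[m/n]*n m n)
  carry : suc r < n ⊎ suc r ≡ n → suc r / n ≡ ⟦ does (n ∣? suc m) ⟧
  carry (inj₁ 1+r<n) = trans (m<n⇒m/n≡0 1+r<n) (sym (⟦no⟧ (n ∣? suc m) n∤1+m))
    where
    n∤1+m : ¬ n ∣ suc m
    n∤1+m n∣1+m =
      <⇒≱ 1+r<n (∣⇒≤ (∣m+n∣m⇒∣n (subst (n ∣_) (trans 1+m≡ (+-comm (suc r) (q * n))) n∣1+m) (n∣m*n q)))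
  carry (inj₂ 1+r≡n) = trans (trans (/-congˡ 1+r≡n) (n/n≡1 n)) (sym (⟦yes⟧ (n ∣? suc m) n∣1+m))
    where
    n∣1+m : n ∣ suc m
    n∣1+m = subst (n ∣_) (sym 1+m≡) (∣m∣n⇒∣m+n (∣-reflexive (sym 1+r≡n)) (n∣m*n q))

count-multiples : ∀ e .{{_ : NonZero e}} N → ∑ N (λ h → ⟦ does (e ∣? h) ⟧) ≡ N / e
count-multiples e zero    = sym (0/n≡0 e)
count-multiples e (suc N) = trans (cong (_+ ⟦ does (e ∣? suc N) ⟧) (count-multiples e N)) (sym (/-suc N e))

countDivisible-≡ : ∀ a d e .{{_ : NonZero e}} N → (∀ h → d ∣ a * h ⇔ e ∣ h) → countDivisible a d N ≡ N / e
countDivisible-≡ a d e N equiv =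
  trans (∑-cong N λ {h} _ _ → cong ⟦_⟧ (does-⇔ (equiv h) (d ∣? a * h) (e ∣? h))) (count-multiples e N)

∣-≡ : ∀ {d d′ x x′} → d ≡ d′ → x ≡ x′ → d ∣ x ⇔ d′ ∣ x′
∣-≡ refl refl = ⇔.refl

coprime-∣*⇔ : ∀ {d a h} → Coprime d a → d ∣ a * h ⇔ d ∣ h
coprime-∣*⇔ {a = a} c = mk⇔ (coprime-divisor c) (∣n⇒∣m*n a)

*∣*⇔ : ∀ c e x .{{_ : NonZero c}} → c * e ∣ c * x ⇔ e ∣ x
*∣*⇔ c _ _ = mk⇔ (*-cancelˡ-∣ c) (*-monoʳ-∣ c)

coprime-+-* : ∀ {r m} q → Coprime r m → Coprime (r + q * m) m
coprime-+-* {r} zero    c = subst (λ x → Coprime x _) (sym (+-identityʳ r)) c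
coprime-+-* {r} {m} (suc q) c = subst (λ x → Coprime x m) (swap-front m r (q * m)) (coprime-+ (coprime-+-* q c))
  where
  swap-front : ∀ m r x → m + (r + x) ≡ r + (m + x)
  swap-front = solve-∀

x+x≡2x : ∀ x → x + x ≡ 2 * x
x+x≡2x x = cong (x +_) (sym (+-identityʳ x))

module _ (n : ℕ) where

  private
    N : ℕ
    N = n / 2

  coprime-case : ∀ d .{{_ : NonZero d}} → Coprime d 6 → countDivisible 6 d N + countDivisible 2 d N ≡ 2 * (N / d)
  coprime-case d c₆ = trans (cong₂ _+_ (countDivisible-≡ 6 d d N λ _ → coprime-∣*⇔ c₆)
                                       (countDivisible-≡ 2 d d N λ _ → coprime-∣*⇔ c₂))
                            (x+x≡2x (N / d))
    where
    c₂ : Coprime d 2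
    c₂ (i∣d , i∣2) = c₆ (i∣d , ∣-trans i∣2 (divides 3 refl))

  double-case : ∀ d e .{{_ : NonZero e}} → d ≡ 2 * e → Coprime e 3 →
                countDivisible 6 d N + countDivisible 2 d N ≡ 2 * (N / e)
  double-case d e d≡2e c₃ = trans (cong₂ _+_ (countDivisible-≡ 6 d e N six) (countDivisible-≡ 2 d e N two)) (x+x≡2x (N / e))
    where
    six : ∀ h → d ∣ 6 * h ⇔ e ∣ h
    six h = ⇔.trans (∣-≡ d≡2e (*-assoc 2 3 h)) (⇔.trans (*∣*⇔ 2 e (3 * h)) (coprime-∣*⇔ c₃))
    two : ∀ h → d ∣ 2 * h ⇔ e ∣ h
    two h = ⇔.trans (∣-≡ d≡2e refl) (*∣*⇔ 2 e h)

  triple-case : ∀ d e .{{_ : NonZero d}} .{{_ : NonZero e}} → d ≡ 3 * e → Coprime d 2 → Coprime e 2 →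
                countDivisible 6 d N + countDivisible 2 d N ≡ N / e + N / d
  triple-case d e d≡3e c₂ c₂′ =
    cong₂ _+_ (countDivisible-≡ 6 d e N six) (countDivisible-≡ 2 d d N λ _ → coprime-∣*⇔ c₂)
    where
    six : ∀ h → d ∣ 6 * h ⇔ e ∣ h
    six h = ⇔.trans (∣-≡ d≡3e (*-assoc 3 2 h)) (⇔.trans (*∣*⇔ 3 e (2 * h)) (coprime-∣*⇔ c₂′))

  sextuple-case : ∀ d e f .{{_ : NonZero e}} .{{_ : NonZero f}} → d ≡ 2 * f → f ≡ 3 * e →
                  countDivisible 6 d N + countDivisible 2 d N ≡ N / e + N / f
  sextuple-case d e f d≡2f f≡3e = cong₂ _+_ (countDivisible-≡ 6 d e N six) (countDivisible-≡ 2 d f N two)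
    where
    six : ∀ h → d ∣ 6 * h ⇔ e ∣ h
    six h = ⇔.trans (∣-≡ (trans d≡2f (trans (cong (2 *_) f≡3e) (sym (*-assoc 2 3 e)))) refl) (*∣*⇔ 6 e h)
    two : ∀ h → d ∣ 2 * h ⇔ f ∣ h
    two h = ⇔.trans (∣-≡ d≡2f refl) (*∣*⇔ 2 f h)

  N/e≡n/k : ∀ e k .{{_ : NonZero e}} .{{_ : NonZero k}} → k ≡ 2 * e → N / e ≡ n / k
  N/e≡n/k e k k≡2e = trans (m/n/o≡m/[n*o] n 2 e) (/-congʳ (sym k≡2e))
    where instance _ = m*n≢0 2 e

  N/e≡3n/k : ∀ e k .{{_ : NonZero e}} .{{_ : NonZero k}} → k ≡ 3 * (2 * e) → N / e ≡ 3 * n / k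
  N/e≡3n/k e k k≡6e = begin
    N / e                  ≡⟨ N/e≡n/k e (2 * e) refl ⟩
    n / (2 * e)            ≡⟨ sym (m*n/m*o≡n/o 3 n (2 * e)) ⟩
    3 * n / (3 * (2 * e))  ≡⟨ /-congʳ (sym k≡6e) ⟩
    3 * n / k              ∎
    where
    instance _ = m*n≢0 2 e
    instance _ = m*n≢0 3 (2 * e)

private
  residue : ∀ d {r} → d % 6 ≡ r → d ≡ r + d / 6 * 6
  residue d d%6≡r = trans (m≡m%n+[m/n]*n d 6) (cong (_+ d / 6 * 6) d%6≡r)

  2+6q≡2[1+3q] : ∀ q → 2 + q * 6 ≡ 2 * (1 + q * 3)
  2+6q≡2[1+3q] = solve-∀
  4+6q≡2[2+3q] : ∀ q → 4 + q * 6 ≡ 2 * (2 + q * 3)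
  4+6q≡2[2+3q] = solve-∀
  3+6q≡3[1+2q] : ∀ q → 3 + q * 6 ≡ 3 * (1 + q * 2)
  3+6q≡3[1+2q] = solve-∀
  3+6q≡1+[1+3q]2 : ∀ q → 3 + q * 6 ≡ 1 + (1 + q * 3) * 2
  3+6q≡1+[1+3q]2 = solve-∀
  6q≡2[3q] : ∀ q → 0 + q * 6 ≡ 2 * (3 * q)
  6q≡2[3q] = solve-∀
  2[3e]≡3[2e] : ∀ e → 2 * (3 * e) ≡ 3 * (2 * e)
  2[3e]≡3[2e] = solve-∀

countDivisible≡P : ∀ d n → 1 ≤ d → countDivisible 6 d (n / 2) + countDivisible 2 d (n / 2) ≡ P d n
countDivisible≡P d@(suc _) n _ with d % 6 in d%6≡r | m%n<n d 6
... | 0 | _ = multiple-of-6 (d / 6) (residue d d%6≡r)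
  where
  multiple-of-6 : ∀ q → d ≡ 0 + q * 6 → countDivisible 6 d (n / 2) + countDivisible 2 d (n / 2) ≡ 3 * n / d + n / d
  multiple-of-6 zero    ()
  multiple-of-6 (suc q) d≡6e = trans (sextuple-case n d e (3 * e) d≡2f refl)
                                     (cong₂ _+_ (N/e≡3n/k n e d (trans d≡2f (2[3e]≡3[2e] e))) (N/e≡n/k n (3 * e) d d≡2f))
    where
    e : ℕ
    e = suc q
    d≡2f : d ≡ 2 * (3 * e)
    d≡2f = trans d≡6e (6q≡2[3q] e)
... | 1 | _ = trans (coprime-case n d (subst (λ x → Coprime x 6) (sym (residue d d%6≡r))
                                             (coprime-+-* (d / 6) (1-coprimeTo 6))))
                   (cong (2 *_) (N/e≡n/k n d (2 * d) refl))
... | 2 | _ = trans (double-case n d e d≡2e (coprime-+-* (d / 6) (1-coprimeTo 3))) (cong (2 *_) (N/e≡n/k n e d d≡2e))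
  where
  e : ℕ
  e = 1 + d / 6 * 3
  d≡2e : d ≡ 2 * e
  d≡2e = trans (residue d d%6≡r) (2+6q≡2[1+3q] (d / 6))
... | 3 | _ = trans (triple-case n d e d≡3e c₂ (coprime-+-* (d / 6) (1-coprimeTo 2)))
                   (cong₂ _+_ (N/e≡3n/k n e (2 * d) (trans (cong (2 *_) d≡3e) (2[3e]≡3[2e] e))) (N/e≡n/k n d (2 * d) refl))
  where
  e : ℕ
  e = 1 + d / 6 * 2
  d≡3e : d ≡ 3 * e
  d≡3e = trans (residue d d%6≡r) (3+6q≡3[1+2q] (d / 6))
  c₂ : Coprime d 2
  c₂ = subst (λ x → Coprime x 2) (sym (trans (residue d d%6≡r) (3+6q≡1+[1+3q]2 (d / 6))))
             (coprime-+-* (1 + d / 6 * 3) (1-coprimeTo 2))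
... | 4 | _ = trans (double-case n d e d≡2e (coprime-+-* (d / 6) (gcd≡1⇒coprime refl))) (cong (2 *_) (N/e≡n/k n e d d≡2e))
  where
  e : ℕ
  e = 2 + d / 6 * 3
  d≡2e : d ≡ 2 * e
  d≡2e = trans (residue d d%6≡r) (4+6q≡2[2+3q] (d / 6))
... | 5 | _ = trans (coprime-case n d (subst (λ x → Coprime x 6) (sym (residue d d%6≡r))
                                             (coprime-+-* (d / 6) (gcd≡1⇒coprime refl))))
                   (cong (2 *_) (N/e≡n/k n d (2 * d) refl))
... | suc (suc (suc (suc (suc (suc _))))) | s≤s (s≤s (s≤s (s≤s (s≤s (s≤s ())))))

lemma6p2 : (n d : ℕ) → 4 ≤ n → 12 ≤ d →
    Σ (List (Vec PM (n + 1))) λ xs →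
    Unique xs ×
    ((v : Vec PM (n + 1)) → (v ∈ xs) ⇔ InL (toSeq v) n d) ×
    (length xs * 2 ^ P d n ≡ (2 ^ P d n ∸ 1) * 2 ^ (n + 1))
lemma6p2 n d _ 12≤d = hitting c (n + 1) , hitting-unique c (n + 1) , membership , count
  where
  1≤d : 1 ≤ d
  1≤d = ≤-trans (s≤s z≤n) 12≤d
  d∤2 : ¬ d ∣ 2
  d∤2 d∣2 = <⇒≱ (≤-trans (s≤s (s≤s (s≤s z≤n))) 12≤d) (∣⇒≤ d∣2)
  c : Forbidden
  c = trigger n d
  membership : (v : Vec PM (n + 1)) → (v ∈ hitting c (n + 1)) ⇔ InL (toSeq v) n d
  membership v = ⇔.trans (∈-hitting c v) (⇔.trans (Hits⇔Triggered n d d∤2 v) (⇔.sym (InL⇔Triggered (toSeq v) 1≤d)))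
  K≡P : forbiddenCount c (n + 1) ≡ P d n
  K≡P = trans (forbiddenCount-trigger n d d∤2 (n / 2) (parity-/2 n)) (countDivisible≡P d n 1≤d)
  count : length (hitting c (n + 1)) * 2 ^ P d n ≡ (2 ^ P d n ∸ 1) * 2 ^ (n + 1)
  count = subst (λ K → length (hitting c (n + 1)) * 2 ^ K ≡ (2 ^ K ∸ 1) * 2 ^ (n + 1)) K≡P (length-hitting c (n + 1))
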